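{- Let $G$ be a finite simple graph without isolated vertices. Then the expected number of connected components of the forest produced by the forest building process on $G$ is \[ \sum_{uv\in E(G)}\frac{1}{d(u)+d(v)-1}, \] where $d(u)$ and $d(v)$ denote the degrees of $u$ and $v$ in $G$.
   Context: Forest building process: let $G$ be a finite simple graph without isolated vertices, with $m$ edges. Choose an ordering $e_1,\dots,e_m$ of $E(G)$ uniformly at random among all $m!$ orderings. Start with the graph $S$ on vertex set $V(G)$ with no edges; for $j=1,\dots,m$ in turn, add $e_j$ to $S$ if and only if $e_j$ is incident to some vertex that is not incident to any $e_i$ with $i<j$. The final $S$ is a spanning forest of $G$, and the number of its connected components is the random quantity in question. -}

module Defs where

open import Data.Bool using (Bool; true; false; _∧_; _∨_; not; if_then_else_)
open import Data.Nat using (ℕ; zero; suc; _∸_; _<_; _!) renaming (_+_ to _+ℕ_)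
open import Data.Nat.Properties using (_!≢0)
open import Data.Fin using (Fin; toℕ; _<?_)
open import Data.Fin.Properties using (_≟_)
open import Data.List using (List; []; _∷_; length; filter; map; concatMap; foldr; allFin)
open import Data.Bool.ListAction using (any)
open import Data.Product using (_×_; _,_; proj₁; proj₂)
open import Data.Integer using (+_)
open import Data.Rational using (ℚ; 0ℚ; _/_) renaming (_+_ to _+ℚ_)
open import Relation.Nullary.Decidable using (⌊_⌋)

-- A finite simple graph on vertex set Fin n is given by a list of edges;
-- an edge is a pair (u , v) with toℕ u < toℕ v (no loops, each unordered
-- pair stored in a canonical orientation); simplicity = the list has no
-- repeated entries (imposed as a hypothesis in the statement).
Edge : ℕ → Set
Edge n = Fin n × Fin n

_==_ : ∀ {n} → Fin n → Fin n → Bool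
a == b = ⌊ a ≟ b ⌋

incident : ∀ {n} → Fin n → Edge n → Bool
incident w (u , v) = (w == u) ∨ (w == v)

deg : ∀ {n} → List (Edge n) → Fin n → ℕ
deg E w = length (filter (λ e → incident w e Data.Bool.≟ true) E)

insertions : ∀ {A : Set} → A → List A → List (List A)
insertions x []       = (x ∷ []) ∷ []
insertions x (y ∷ ys) = (x ∷ y ∷ ys) ∷ map (y ∷_) (insertions x ys)

orderings : ∀ {A : Set} → List A → List (List A)
orderings []       = [] ∷ []
orderings (x ∷ xs) = concatMap (insertions x) (orderings xs)

covers : ∀ {n} → List (Edge n) → Fin n → Bool
covers C w = any (incident w) C

build : ∀ {n} → List (Edge n) → List (Edge n) → List (Edge n)
build earlier []             = []
build earlier ((u , v) ∷ es) =
  if not (covers earlier u) ∨ not (covers earlier v)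
  then (u , v) ∷ build ((u , v) ∷ earlier) es
  else build ((u , v) ∷ earlier) es

forestOf : ∀ {n} → List (Edge n) → List (Edge n)
forestOf ordering = build [] ordering

adj : ∀ {n} → List (Edge n) → Fin n → Fin n → Bool
adj S a b = any (λ e → ((proj₁ e == a) ∧ (proj₂ e == b)) ∨ ((proj₁ e == b) ∧ (proj₂ e == a))) S

reachK : ∀ {n} → List (Edge n) → ℕ → Fin n → Fin n → Bool
reachK S zero    a b = a == b
reachK S (suc k) a b = reachK S k a b ∨ any (λ w → reachK S k a w ∧ adj S w b) (allFin _)

-- connectivity in a graph on n vertices: a walk of length ≤ n exists
-- (every path has length < n, so this is exactly connectivity)
connected : ∀ {n} → List (Edge n) → Fin n → Fin n → Bool
connected {n} S a b = reachK S n a b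

-- number of connected components: count the vertices that are the
-- least (w.r.t. the order of Fin n) vertex of their component
components : ∀ {n} → List (Edge n) → ℕ
components {n} S =
  length (filter (λ v → not (any (λ u → ⌊ u <? v ⌋ ∧ connected S u v) (allFin n)) Data.Bool.≟ true) (allFin n))

sumℚ : List ℚ → ℚ
sumℚ = foldr _+ℚ_ 0ℚ

-- 1/k as a rational (the value at k = 0 is irrelevant; never used)
recip : ℕ → ℚ
recip zero    = 0ℚ
recip (suc k) = (+ 1) / suc k

-- Expected number of components of the forest built by the process,
-- over a uniformly random ordering of the m = length E edges:
-- (1/m!) · Σ_{orderings σ} components(forest(σ)).
expectedComponents : ∀ {n} → List (Edge n) → ℚ
expectedComponents {n} E =
  (+ foldr _+ℕ_ 0 (map (λ σ → components (forestOf σ)) (orderings E)))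
    / (length E !) 
  where instance _ = length E !≢0

formula : ∀ {n} → List (Edge n) → ℚ
formula E = sumℚ (map (λ e → recip (deg E (proj₁ e) +ℕ deg E (proj₂ e) ∸ 1)) E)

module Submission where

-- In an ordering, call an edge a leader if it comes before every other edge sharing an endpoint with it.
-- The forest built along an ordering has as many components as the ordering has leaders: the quantity
-- (components of S) − (vertices not yet covered) starts at n − n = 0, ends at the number of components,
-- and changes only when an edge is added, by +1 if both endpoints were uncovered (a leader) and by 0 if
-- one was (a pendant vertex joins a component).  An edge uv shares an endpoint with d(u) + d(v) − 1
-- edges, itself included, and each of these is equally often the first of them, so uv leads in a
-- 1/(d(u) + d(v) − 1) fraction of the orderings.

open import Defs
open import Data.Nat using (ℕ; _<_)
open import Data.Fin using (toℕ)
open import Data.Product using (_×_; proj₁; proj₂)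
open import Data.Sum using (_⊎_)
open import Data.List using (List)
open import Data.List.Relation.Unary.All using (All)
open import Data.List.Relation.Unary.Any using (Any)
open import Data.List.Relation.Unary.Unique.Propositional using (Unique)
open import Relation.Binary.PropositionalEquality using (_≡_)

open import Algebra.Bundles using (CommutativeMonoid)
open import Data.Bool using (Bool; true; false; _∧_; _∨_; not; if_then_else_)
import Data.Bool as Bool
open import Data.Bool.ListAction using (any)
open import Data.Bool.Properties
  using ( ∧-comm; ∧-zeroʳ; ∧-identityʳ; ∧-inverseʳ; ∨-comm; ∨-zeroʳ; ∨-identityʳ; ∨-conicalˡ; ∨-conicalʳ
        ; ∨-isCommutativeMonoid; ∨-commutativeMonoid; ⇔→≡; ¬-not)
open import Data.Fin using (Fin; zero; suc; _<?_)
open import Data.Fin.Properties using (_≟_; toℕ-injective)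
import Data.Integer as ℤ
import Data.Integer.Properties as ℤ
open import Data.Integer.Properties using (pos-+; pos-*)
import Data.Integer.Tactic.RingSolver as ℤ-Solver
open import Data.List using ([]; _∷_; _++_; length; map; concatMap; filter; allFin)
open import Data.List.Membership.Propositional using (_∈_; find)
open import Data.List.Membership.Propositional.Properties using (∈-map⁻; ∈-concatMap⁻; ∈-allFin)
open import Data.List.Properties using (map-cong-local; map-∘; length-map; length-++; length-tabulate; ++-identityʳ)
open import Data.List.Relation.Binary.Permutation.Propositional
  using (_↭_; ↭-refl; ↭-prep; ↭-swap; ↭-trans; ↭-sym; ↭⇒↭ₛ)
open import Data.List.Relation.Binary.Permutation.Propositional.Properties
  using (map⁺; ↭-length; ∈-resp-↭; shift; All-resp-↭)
import Data.List.Relation.Binary.Permutation.Setoid.Properties as PermutationSetoid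
open import Data.List.Relation.Unary.All using ([]; _∷_)
import Data.List.Relation.Unary.All as All
open import Data.List.Relation.Unary.AllPairs using (_∷_)
open import Data.List.Relation.Unary.Any using (here; there)
open import Data.List.Relation.Unary.Unique.Propositional.Properties using (allFin⁺)
open import Data.Nat using (zero; suc; _+_; _*_; _∸_; _≤_; z≤n; s≤s; _!; NonZero)
open import Data.Nat.ListAction using (sum)
open import Data.Nat.ListAction.Properties using (sum-↭)
open import Data.Nat.Properties
  using ( +-assoc; +-comm; +-suc; +-identityʳ; +-cancelˡ-≡; +-mono-≤; *-identityˡ; *-zeroʳ; *-suc; *-distribʳ-+
        ; suc-injective; m+n∸n≡m; _!≢0; ≤-refl; ≤-reflexive; ≤-trans; m≤n+m; m≤m+n; m≤n⇒m≤1+n; n≤1+n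
        ; m≤n⇒∃[o]m+o≡n; <-irrefl; <-asym; <-trans; <-cmp; ≤∧≢⇒<; ≮⇒≥; +-commutativeSemigroup)
open import Data.Nat.Tactic.RingSolver using (solve-∀)
open import Data.Product using (∃-syntax; _,_)
open import Data.Product.Properties using (≡-dec)
open import Data.Rational using (_/_; toℚᵘ; fromℚᵘ)
import Data.Rational as ℚ
open import Data.Rational.Properties using (toℚᵘ-injective; toℚᵘ-fromℚᵘ; toℚᵘ-homo-+; fromℚᵘ-cong; 0/n≡0)
open import Data.Rational.Unnormalised using (mkℚᵘ; *≡*)
import Data.Rational.Unnormalised as ℚᵘ
import Data.Rational.Unnormalised.Properties as ℚᵘ
open import Data.Sum using (inj₁; inj₂; [_,_])
open import Function using (_∘_; id; mk⇔)
open import Relation.Binary using (DecidableEquality; tri<; tri≈; tri>)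
open import Relation.Binary.PropositionalEquality using (refl; sym; trans; cong; cong₂; subst; setoid; _≢_; module ≡-Reasoning)
open import Relation.Nullary using (Dec; ¬_; yes; no; contradiction)
open import Relation.Nullary.Decidable using (⌊_⌋; dec-true; dec-false; isYes≗does)
open import Algebra.Properties.CommutativeSemigroup +-commutativeSemigroup using (interchange; x∙yz≈y∙xz)
open import Algebra.Properties.CommutativeSemigroup (CommutativeMonoid.commutativeSemigroup ∨-commutativeMonoid)
  using () renaming (interchange to ∨-interchange)

private variable A B : Set

-- Booleans and counting

⌊⌋-true : {P : Set} (P? : Dec P) → P → ⌊ P? ⌋ ≡ true
⌊⌋-true P? p = trans (isYes≗does P?) (dec-true P? p)

⌊⌋-false : {P : Set} (P? : Dec P) → ¬ P → ⌊ P? ⌋ ≡ false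
⌊⌋-false P? ¬p = trans (isYes≗does P?) (dec-false P? ¬p)

∧-true⁻ : {a b : Bool} → a ∧ b ≡ true → a ≡ true × b ≡ true
∧-true⁻ {true} {true} _ = refl , refl

∧-true⁺ : {a b : Bool} → a ≡ true → b ≡ true → a ∧ b ≡ true
∧-true⁺ refl refl = refl

∨-true⁻ : {a b : Bool} → a ∨ b ≡ true → a ≡ true ⊎ b ≡ true
∨-true⁻ {true}  _ = inj₁ refl
∨-true⁻ {false} b = inj₂ b

∨-true⁺ˡ : {a : Bool} (b : Bool) → a ≡ true → a ∨ b ≡ true
∨-true⁺ˡ b refl = refl

∨-true⁺ʳ : (a : Bool) {b : Bool} → b ≡ true → a ∨ b ≡ true
∨-true⁺ʳ a refl = ∨-zeroʳ a

not-true⇒false : {a : Bool} → not a ≡ true → a ≡ false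
not-true⇒false {false} _ = refl

not-false⇒true : {a : Bool} → not a ≡ false → a ≡ true
not-false⇒true {true} _ = refl

∧-false-true : {a b : Bool} → a ∧ b ≡ false → a ≡ true → b ≡ false
∧-false-true a∧b refl = a∧b

indicator : Bool → ℕ
indicator true  = 1
indicator false = 0

count : (A → Bool) → List A → ℕ
count p xs = sum (map (indicator ∘ p) xs)

sum-map-cong : {f g : A → ℕ} (xs : List A) → (∀ x → x ∈ xs → f x ≡ g x) →
  sum (map f xs) ≡ sum (map g xs)
sum-map-cong xs f≗g = cong sum (map-cong-local (All.tabulate (f≗g _)))

sum-map-+ : (f g : A → ℕ) (xs : List A) → sum (map (λ x → f x + g x) xs) ≡ sum (map f xs) + sum (map g xs)
sum-map-+ f g []       = refl
sum-map-+ f g (x ∷ xs) = trans (cong (f x + g x +_) (sum-map-+ f g xs)) (interchange (f x) (g x) _ _)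

sum-map-*ʳ : (f : A → ℕ) (k : ℕ) (xs : List A) → sum (map f xs) * k ≡ sum (map (λ x → f x * k) xs)
sum-map-*ʳ f k []       = refl
sum-map-*ʳ f k (x ∷ xs) = trans (*-distribʳ-+ k (f x) _) (cong (f x * k +_) (sum-map-*ʳ f k xs))

sum-map-const : (c : ℕ) (xs : List A) → sum (map (λ _ → c) xs) ≡ c * length xs
sum-map-const c []       = sym (*-zeroʳ c)
sum-map-const c (x ∷ xs) = trans (cong (c +_) (sum-map-const c xs)) (sym (*-suc c (length xs)))

sum-map-∘ : (f : B → ℕ) (g : A → B) (xs : List A) → sum (map f (map g xs)) ≡ sum (map (f ∘ g) xs)
sum-map-∘ f g xs = cong sum (sym (map-∘ xs))

sum-map-++ : (f : A → ℕ) (xs ys : List A) → sum (map f (xs ++ ys)) ≡ sum (map f xs) + sum (map f ys)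
sum-map-++ f []       ys = refl
sum-map-++ f (x ∷ xs) ys = trans (cong (f x +_) (sum-map-++ f xs ys)) (sym (+-assoc (f x) _ _))

sum-map-concatMap : (f : B → ℕ) (g : A → List B) (xs : List A) →
  sum (map f (concatMap g xs)) ≡ sum (map (λ x → sum (map f (g x))) xs)
sum-map-concatMap f g []       = refl
sum-map-concatMap f g (x ∷ xs) =
  trans (sum-map-++ f (g x) (concatMap g xs)) (cong (sum (map f (g x)) +_) (sum-map-concatMap f g xs))

sum-map-swap : (f : A → B → ℕ) (xs : List A) (ys : List B) →
  sum (map (λ x → sum (map (f x) ys)) xs) ≡ sum (map (λ y → sum (map (λ x → f x y) xs)) ys)
sum-map-swap f []       ys = sym (sum-map-const 0 ys)
sum-map-swap f (x ∷ xs) ys = trans (cong (sum (map (f x) ys) +_) (sum-map-swap f xs ys)) (sym (sum-map-+ (f x) _ ys))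

count-↭ : (p : A → Bool) {xs ys : List A} → xs ↭ ys → count p xs ≡ count p ys
count-↭ p xs↭ys = sum-↭ (map⁺ (indicator ∘ p) xs↭ys)

count-filter : (p : A → Bool) (xs : List A) → length (filter (λ x → p x Bool.≟ true) xs) ≡ count p xs
count-filter p []       = refl
count-filter p (x ∷ xs) with p x
... | true  = cong suc (count-filter p xs)
... | false = count-filter p xs

count-cong : {p q : A → Bool} (xs : List A) → (∀ x → x ∈ xs → p x ≡ q x) → count p xs ≡ count q xs
count-cong xs p≗q = sum-map-cong xs (λ x x∈xs → cong indicator (p≗q x x∈xs))

count≤length : (p : A → Bool) (xs : List A) → count p xs ≤ length xs
count≤length p []       = z≤n
count≤length p (x ∷ xs) = +-mono-≤ (indicator≤1 (p x)) (count≤length p xs)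
  where
  indicator≤1 : ∀ b → indicator b ≤ 1
  indicator≤1 true  = s≤s z≤n
  indicator≤1 false = z≤n

indicator-mono : {a b : Bool} → (a ≡ true → b ≡ true) → indicator a ≤ indicator b
indicator-mono {true}  a⇒b rewrite a⇒b refl = ≤-refl
indicator-mono {false} a⇒b = z≤n

count-mono : {p q : A → Bool} (xs : List A) → (∀ x → p x ≡ true → q x ≡ true) → count p xs ≤ count q xs
count-mono []       p⇒q = z≤n
count-mono (x ∷ xs) p⇒q = +-mono-≤ (indicator-mono (p⇒q x)) (count-mono xs p⇒q)

count-mono-< : {p q : A → Bool} (xs : List A) → (∀ x → p x ≡ true → q x ≡ true) →
  ∀ {z} → z ∈ xs → p z ≡ false → q z ≡ true → count p xs < count q xs
count-mono-< (x ∷ xs) p⇒q (here refl) pz qz rewrite pz | qz = s≤s (count-mono xs p⇒q)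
count-mono-< {p = p} (x ∷ xs) p⇒q (there z∈xs) pz qz =
  ≤-trans (≤-reflexive (sym (+-suc (indicator (p x)) _)))
          (+-mono-≤ (indicator-mono (p⇒q x)) (count-mono-< xs p⇒q z∈xs pz qz))

count-pos : (p : A → Bool) {xs : List A} {z : A} → z ∈ xs → p z ≡ true → 0 < count p xs
count-pos p (here refl) pz rewrite pz = s≤s z≤n
count-pos p {x ∷ xs} (there z∈xs) pz = ≤-trans (count-pos p z∈xs pz) (m≤n+m _ (indicator (p x)))

count-all : (p : A → Bool) (xs : List A) → (∀ x → x ∈ xs → p x ≡ true) → count p xs ≡ length xs
count-all p []       all-p = refl
count-all p (x ∷ xs) all-p rewrite all-p x (here refl) =
  cong suc (count-all p xs (λ y y∈xs → all-p y (there y∈xs)))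

count-none : (p : A → Bool) (xs : List A) → (∀ x → x ∈ xs → p x ≡ false) → count p xs ≡ 0
count-none p []       no-p = refl
count-none p (x ∷ xs) no-p rewrite no-p x (here refl) = count-none p xs (λ y y∈xs → no-p y (there y∈xs))

count-not : (p : A → Bool) (xs : List A) → count p xs + count (not ∘ p) xs ≡ length xs
count-not p []       = refl
count-not p (x ∷ xs) with p x
... | true  = cong suc (count-not p xs)
... | false = trans (+-suc (count p xs) _) (cong suc (count-not p xs))

count-∨-∧ : (p q : A → Bool) (xs : List A) →
  count (λ x → p x ∨ q x) xs + count (λ x → p x ∧ q x) xs ≡ count p xs + count q xs
count-∨-∧ p q xs = begin
  count (λ x → p x ∨ q x) xs + count (λ x → p x ∧ q x) xs
    ≡⟨ sum-map-+ (λ x → indicator (p x ∨ q x)) _ xs ⟨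
  sum (map (λ x → indicator (p x ∨ q x) + indicator (p x ∧ q x)) xs)
    ≡⟨ sum-map-cong xs (λ x _ → indicator-∨-∧ (p x) (q x)) ⟩
  sum (map (λ x → indicator (p x) + indicator (q x)) xs)
    ≡⟨ sum-map-+ (indicator ∘ p) (indicator ∘ q) xs ⟩
  count p xs + count q xs ∎
  where
  open ≡-Reasoning
  indicator-∨-∧ : ∀ a b → indicator (a ∨ b) + indicator (a ∧ b) ≡ indicator a + indicator b
  indicator-∨-∧ true  true  = refl
  indicator-∨-∧ true  false = refl
  indicator-∨-∧ false true  = refl
  indicator-∨-∧ false false = refl

module _ {A : Set} (_≟_ : DecidableEquality A) where

  count-split : (p : A → Bool) {xs : List A} → Unique xs → ∀ {z} → z ∈ xs →
    count p xs ≡ indicator (p z) + count (λ x → p x ∧ not ⌊ x ≟ z ⌋) xs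
  count-split p (z∉xs ∷ _) (here {x = z} {xs = xs} refl) rewrite ⌊⌋-true (z ≟ z) refl | ∧-zeroʳ (p z) =
    cong (indicator (p z) +_) (count-cong xs p≗p∧≢z)
    where
    p≗p∧≢z : ∀ x → x ∈ xs → p x ≡ p x ∧ not ⌊ x ≟ z ⌋
    p≗p∧≢z x x∈xs rewrite ⌊⌋-false (x ≟ z) (All.lookup z∉xs x∈xs ∘ sym) = sym (∧-identityʳ (p x))
  count-split p (x∉xs ∷ xs-unique) {z} (there {x = x} {xs = xs} z∈xs)
    rewrite ⌊⌋-false (x ≟ z) (All.lookup x∉xs z∈xs) | ∧-identityʳ (p x) | count-split p xs-unique z∈xs =
    x∙yz≈y∙xz (indicator (p x)) (indicator (p z)) (count (λ y → p y ∧ not ⌊ y ≟ z ⌋) xs)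

  count-≟ : {xs : List A} → Unique xs → ∀ {z} → z ∈ xs → count (λ x → ⌊ x ≟ z ⌋) xs ≡ 1
  count-≟ {xs} xs-unique {z} z∈xs = begin
    count (λ x → ⌊ x ≟ z ⌋) xs
      ≡⟨ count-split (λ x → ⌊ x ≟ z ⌋) xs-unique z∈xs ⟩
    indicator ⌊ z ≟ z ⌋ + count (λ x → ⌊ x ≟ z ⌋ ∧ not ⌊ x ≟ z ⌋) xs
      ≡⟨ cong₂ _+_ (cong indicator (⌊⌋-true (z ≟ z) refl)) (count-none _ xs (λ x _ → ∧-inverseʳ ⌊ x ≟ z ⌋)) ⟩
    1 ∎
    where open ≡-Reasoning

any-cong : {p q : A → Bool} (xs : List A) → (∀ x → x ∈ xs → p x ≡ q x) → any p xs ≡ any q xs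
any-cong []       p≗q = refl
any-cong (x ∷ xs) p≗q = cong₂ _∨_ (p≗q x (here refl)) (any-cong xs (λ y y∈xs → p≗q y (there y∈xs)))

any-true⁺ : (p : A → Bool) {xs : List A} {z : A} → z ∈ xs → p z ≡ true → any p xs ≡ true
any-true⁺ p (here refl) pz = ∨-true⁺ˡ _ pz
any-true⁺ p {x ∷ _} (there z∈xs) pz = ∨-true⁺ʳ (p x) (any-true⁺ p z∈xs pz)

any-true⁻ : (p : A → Bool) (xs : List A) → any p xs ≡ true → ∃[ z ] (z ∈ xs × p z ≡ true)
any-true⁻ p (x ∷ xs) any-p with ∨-true⁻ {p x} any-p
... | inj₁ px   = x , here refl , px
... | inj₂ any′ = let z , z∈xs , pz = any-true⁻ p xs any′ in z , there z∈xs , pz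

any-false⁺ : (p : A → Bool) (xs : List A) → (∀ z → z ∈ xs → p z ≡ false) → any p xs ≡ false
any-false⁺ p []       none = refl
any-false⁺ p (x ∷ xs) none rewrite none x (here refl) = any-false⁺ p xs (λ z z∈xs → none z (there z∈xs))

any-false⁻ : (p : A → Bool) {xs : List A} → any p xs ≡ false → ∀ {z} → z ∈ xs → p z ≡ false
any-false⁻ p {x ∷ _} none (here refl)  = ∨-conicalˡ (p x) _ none
any-false⁻ p {x ∷ _} none (there z∈xs) = any-false⁻ p (∨-conicalʳ (p x) _ none) z∈xs

any-↭ : (p : A → Bool) {xs ys : List A} → xs ↭ ys → any p xs ≡ any p ys
any-↭ p xs↭ys =
  PermutationSetoid.foldr-commMonoid (setoid Bool) ∨-isCommutativeMonoid (↭⇒↭ₛ (map⁺ p xs↭ys))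

any-∨ : (p q : A → Bool) (xs : List A) → any (λ x → p x ∨ q x) xs ≡ any p xs ∨ any q xs
any-∨ p q []       = refl
any-∨ p q (x ∷ xs) = trans (cong ((p x ∨ q x) ∨_) (any-∨ p q xs)) (∨-interchange (p x) (q x) _ _)

-- Orderings

Unique-resp-↭ : {xs ys : List A} → xs ↭ ys → Unique xs → Unique ys
Unique-resp-↭ {A = A} xs↭ys = PermutationSetoid.Unique-resp-↭ (setoid A) (↭⇒↭ₛ xs↭ys)

insertions-↭ : (x : A) (τ : List A) {σ : List A} → σ ∈ insertions x τ → σ ↭ x ∷ τ
insertions-↭ x []       (here refl) = ↭-refl
insertions-↭ x (y ∷ ys) (here refl) = ↭-refl
insertions-↭ x (y ∷ ys) (there σ∈) with ∈-map⁻ (y ∷_) σ∈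
... | σ′ , σ′∈ , refl = ↭-trans (↭-prep y (insertions-↭ x ys σ′∈)) (↭-swap y x ↭-refl)

orderings-↭ : (xs : List A) {σ : List A} → σ ∈ orderings xs → σ ↭ xs
orderings-↭ []       (here refl) = ↭-refl
orderings-↭ (x ∷ xs) σ∈ with find (∈-concatMap⁻ (insertions x) {xs = orderings xs} σ∈)
... | τ , τ∈ , σ∈ins = ↭-trans (insertions-↭ x τ σ∈ins) (↭-prep x (orderings-↭ xs τ∈))

length-insertions : (x : A) (τ : List A) → length (insertions x τ) ≡ suc (length τ)
length-insertions x []       = refl
length-insertions x (y ∷ ys) = cong suc (trans (length-map (y ∷_) (insertions x ys)) (length-insertions x ys))

length-concatMap : (f : A → List B) (xs : List A) → length (concatMap f xs) ≡ sum (map (length ∘ f) xs)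
length-concatMap f []       = refl
length-concatMap f (x ∷ xs) = trans (length-++ (f x)) (cong (length (f x) +_) (length-concatMap f xs))

length-orderings : (xs : List A) → length (orderings xs) ≡ length xs !
length-orderings []       = refl
length-orderings (x ∷ xs) = begin
  length (concatMap (insertions x) (orderings xs))            ≡⟨ length-concatMap (insertions x) (orderings xs) ⟩
  sum (map (length ∘ insertions x) (orderings xs))            ≡⟨ sum-map-cong (orderings xs) length-ins ⟩
  sum (map (λ _ → suc (length xs)) (orderings xs))            ≡⟨ sum-map-const (suc (length xs)) (orderings xs) ⟩
  suc (length xs) * length (orderings xs)                     ≡⟨ cong (suc (length xs) *_) (length-orderings xs) ⟩
  suc (length xs) * length xs !                               ∎
  where
  open ≡-Reasoning
  length-ins : ∀ τ → τ ∈ orderings xs → length (insertions x τ) ≡ suc (length xs)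
  length-ins τ τ∈ = trans (length-insertions x τ) (cong suc (↭-length (orderings-↭ xs τ∈)))

picks : List A → List (A × List A)
picks []       = []
picks (x ∷ xs) = (x , xs) ∷ map (λ (y , ys) → y , x ∷ ys) (picks xs)

picks-↭ : (xs : List A) {y : A} {ys : List A} → (y , ys) ∈ picks xs → xs ↭ y ∷ ys
picks-↭ (x ∷ xs) (here refl) = ↭-refl
picks-↭ (x ∷ xs) (there p∈) with ∈-map⁻ (λ (y , ys) → y , x ∷ ys) p∈
... | _ , p∈′ , refl = ↭-trans (↭-prep x (picks-↭ xs p∈′)) (↭-swap x _ ↭-refl)

sum-picks : (f : A → ℕ) (xs : List A) → sum (map (f ∘ proj₁) (picks xs)) ≡ sum (map f xs)
sum-picks f []       = refl
sum-picks f (x ∷ xs) = cong (f x +_) (trans (sum-map-∘ (f ∘ proj₁) _ (picks xs)) (sum-picks f xs))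

sum-orderings-by-head : (φ : List A → ℕ) → φ [] ≡ 0 → (xs : List A) →
  sum (map φ (orderings xs)) ≡ sum (map (λ (y , ys) → sum (map (φ ∘ (y ∷_)) (orderings ys))) (picks xs))
sum-orderings-by-head φ φ[]≡0 []       = trans (+-identityʳ (φ [])) φ[]≡0
sum-orderings-by-head {A = A} φ φ[]≡0 (x ∷ xs) = begin
  sum (map φ (concatMap (insertions x) (orderings xs)))
    ≡⟨ sum-map-concatMap φ (insertions x) (orderings xs) ⟩
  sum (map (λ τ → sum (map φ (insertions x τ))) (orderings xs))
    ≡⟨ sum-map-cong (orderings xs) (λ τ _ → sum-insertions τ) ⟩
  sum (map (λ τ → φ (x ∷ τ) + afterHead τ) (orderings xs))
    ≡⟨ sum-map-+ (φ ∘ (x ∷_)) afterHead (orderings xs) ⟩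
  byHead (x , xs) + sum (map afterHead (orderings xs))
    ≡⟨ cong (byHead (x , xs) +_) (sum-orderings-by-head afterHead refl xs) ⟩
  byHead (x , xs) + sum (map (λ (y , ys) → sum (map (afterHead ∘ (y ∷_)) (orderings ys))) (picks xs))
    ≡⟨ cong (byHead (x , xs) +_) (sum-map-cong (picks xs) λ (y , ys) _ →
         sym (sum-map-concatMap (φ ∘ (y ∷_)) (insertions x) (orderings ys))) ⟩
  byHead (x , xs) + sum (map (byHead ∘ (λ (y , ys) → y , x ∷ ys)) (picks xs))
    ≡⟨ cong (byHead (x , xs) +_) (sum-map-∘ byHead (λ (y , ys) → y , x ∷ ys) (picks xs)) ⟨
  byHead (x , xs) + sum (map byHead (map (λ (y , ys) → y , x ∷ ys) (picks xs))) ∎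
  where
  open ≡-Reasoning
  byHead : A × List A → ℕ
  byHead (y , ys) = sum (map (φ ∘ (y ∷_)) (orderings ys))
  afterHead : List A → ℕ
  afterHead []       = 0
  afterHead (y ∷ ys) = sum (map (φ ∘ (y ∷_)) (insertions x ys))
  sum-insertions : ∀ τ → sum (map φ (insertions x τ)) ≡ φ (x ∷ τ) + afterHead τ
  sum-insertions []       = refl
  sum-insertions (y ∷ ys) = cong (φ (x ∷ y ∷ ys) +_) (sum-map-∘ φ (y ∷_) (insertions x ys))

module _ {A : Set} (_≟_ : DecidableEquality A) where

  leads : (A → Bool) → A → List A → Bool
  leads P e []       = false
  leads P e (x ∷ xs) = if P x then ⌊ x ≟ e ⌋ else leads P e xs

  -- Either the head y lies in P and decides alone, or it does not and the question passes to ys.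
  count-leads-after : (P : A → Bool) {e : A} → P e ≡ true → {xs : List A} {y : A} {ys : List A} →
    xs ↭ y ∷ ys → Unique xs → e ∈ xs →
    (Unique ys → e ∈ ys → count (leads P e) (orderings ys) * count P ys ≡ length ys !) →
    count (leads P e ∘ (y ∷_)) (orderings ys) * count P xs
      ≡ (indicator (P y ∧ ⌊ y ≟ e ⌋) * count P xs + indicator (not (P y))) * length ys !
  count-leads-after P {e} Pe {xs} {y} {ys} xs↭y∷ys xs-unique e∈xs count-leads-ys with P y in Py
  ... | true = begin
    count (λ _ → ⌊ y ≟ e ⌋) (orderings ys) * k
      ≡⟨ cong (_* k) (sum-map-const _ (orderings ys)) ⟩
    indicator ⌊ y ≟ e ⌋ * length (orderings ys) * k
      ≡⟨ cong (λ l → indicator ⌊ y ≟ e ⌋ * l * k) (length-orderings ys) ⟩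
    indicator ⌊ y ≟ e ⌋ * length ys ! * k
      ≡⟨ a*b*c≡[a*c+0]*b (indicator ⌊ y ≟ e ⌋) (length ys !) k ⟩
    (indicator ⌊ y ≟ e ⌋ * k + 0) * length ys ! ∎
    where
    open ≡-Reasoning
    k : ℕ
    k = count P xs
    a*b*c≡[a*c+0]*b : ∀ a b c → a * b * c ≡ (a * c + 0) * b
    a*b*c≡[a*c+0]*b = solve-∀
  ... | false = begin
    count (leads P e) (orderings ys) * count P xs    ≡⟨ cong (count (leads P e) (orderings ys) *_) count-P ⟩
    count (leads P e) (orderings ys) * count P ys    ≡⟨ count-leads-ys ys-unique e∈ys ⟩
    length ys !                                      ≡⟨ +-identityʳ (length ys !) ⟨
    length ys ! + 0                                  ∎
    where
    open ≡-Reasoning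
    ys-unique : Unique ys
    ys-unique with Unique-resp-↭ xs↭y∷ys xs-unique
    ... | _ ∷ ys-unique = ys-unique
    e∈ys : e ∈ ys
    e∈ys with ∈-resp-↭ xs↭y∷ys e∈xs
    ... | here refl  = contradiction (trans (sym Pe) Py) λ ()
    ... | there e∈ys = e∈ys
    count-P : count P xs ≡ count P ys
    count-P = trans (count-↭ P xs↭y∷ys) (cong (λ b → indicator b + count P ys) Py)

  count-leads : (P : A → Bool) {e : A} → P e ≡ true → (m : ℕ) {xs : List A} →
    length xs ≡ m → Unique xs → e ∈ xs → count (leads P e) (orderings xs) * count P xs ≡ m !
  count-leads P Pe zero    {[]} _ _ ()
  count-leads P {e} Pe (suc m) {xs} |xs|≡1+m xs-unique e∈xs = begin
    count (leads P e) (orderings xs) * k      ≡⟨ cong (_* k) (sum-orderings-by-head _ refl xs) ⟩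
    sum (map byHead (picks xs)) * k           ≡⟨ sum-map-*ʳ byHead k (picks xs) ⟩
    sum (map (λ p → byHead p * k) (picks xs)) ≡⟨ sum-map-cong (picks xs) byHead*k ⟩
    sum (map (weight ∘ proj₁) (picks xs))     ≡⟨ sum-picks weight xs ⟩
    sum (map weight xs)                       ≡⟨ sum-map-*ʳ weight′ (m !) xs ⟨
    sum (map weight′ xs) * m !                ≡⟨ cong (_* m !) sum-weight′ ⟩
    suc m * m !                               ∎
    where
    open ≡-Reasoning
    k : ℕ
    k = count P xs
    byHead : A × List A → ℕ
    byHead (y , ys) = count (leads P e ∘ (y ∷_)) (orderings ys)
    weight′ weight : A → ℕ
    weight′ y = indicator (P y ∧ ⌊ y ≟ e ⌋) * k + indicator (not (P y))
    weight y = weight′ y * m !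

    byHead*k : ∀ p → p ∈ picks xs → byHead p * k ≡ weight (proj₁ p)
    byHead*k (y , ys) p∈ = trans (count-leads-after P Pe xs↭y∷ys xs-unique e∈xs count-leads-ys)
                                 (cong (λ l → weight′ y * l !) |ys|≡m)
      where
      xs↭y∷ys : xs ↭ y ∷ ys
      xs↭y∷ys = picks-↭ xs p∈
      |ys|≡m : length ys ≡ m
      |ys|≡m = suc-injective (trans (sym (↭-length xs↭y∷ys)) |xs|≡1+m)
      count-leads-ys : Unique ys → e ∈ ys → count (leads P e) (orderings ys) * count P ys ≡ length ys !
      count-leads-ys ys-unique e∈ys = trans (count-leads P Pe m |ys|≡m ys-unique e∈ys) (cong _! (sym |ys|≡m))

    unique-leader : count (λ y → P y ∧ ⌊ y ≟ e ⌋) xs ≡ 1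
    unique-leader = trans (count-cong xs (λ y _ → P∧≟ y)) (count-≟ _≟_ xs-unique e∈xs)
      where
      P∧≟ : ∀ y → (P y ∧ ⌊ y ≟ e ⌋) ≡ ⌊ y ≟ e ⌋
      P∧≟ y with y ≟ e
      ... | yes refl = cong (_∧ true) Pe
      ... | no _     = ∧-zeroʳ (P y)

    sum-weight′ : sum (map weight′ xs) ≡ suc m
    sum-weight′ = begin
      sum (map weight′ xs)
        ≡⟨ sum-map-+ _ _ xs ⟩
      sum (map (λ y → indicator (P y ∧ ⌊ y ≟ e ⌋) * k) xs) + count (not ∘ P) xs
        ≡⟨ cong (_+ count (not ∘ P) xs) (sum-map-*ʳ _ k xs) ⟨
      count (λ y → P y ∧ ⌊ y ≟ e ⌋) xs * k + count (not ∘ P) xs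
        ≡⟨ cong (λ c → c * k + count (not ∘ P) xs) unique-leader ⟩
      1 * k + count (not ∘ P) xs
        ≡⟨ cong (_+ count (not ∘ P) xs) (*-identityˡ k) ⟩
      k + count (not ∘ P) xs
        ≡⟨ trans (count-not P xs) |xs|≡1+m ⟩
      suc m ∎

-- Connectivity

module _ {n : ℕ} where

  ==-refl : (a : Fin n) → (a == a) ≡ true
  ==-refl a = ⌊⌋-true (a ≟ a) refl

  ==⇒≡ : {a b : Fin n} → (a == b) ≡ true → a ≡ b
  ==⇒≡ {a = a} {b = b} a==b with a ≟ b
  ... | yes a≡b = a≡b

  ==-sym : (a b : Fin n) → (a == b) ≡ (b == a)
  ==-sym a b with a ≟ b
  ... | yes refl = sym (==-refl a)
  ... | no a≢b   = sym (⌊⌋-false (b ≟ a) (a≢b ∘ sym))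

  adj-sym : (S : List (Edge n)) (a b : Fin n) → adj S a b ≡ adj S b a
  adj-sym S a b = any-cong S (λ (x , y) _ → ∨-comm ((x == a) ∧ (y == b)) ((x == b) ∧ (y == a)))

  module _ (S : List (Edge n)) where

    reach-weaken : ∀ k {a b} → reachK S k a b ≡ true → reachK S (suc k) a b ≡ true
    reach-weaken k = ∨-true⁺ˡ _

    reach-extend : ∀ k {a w b} → reachK S k a w ≡ true → adj S w b ≡ true → reachK S (suc k) a b ≡ true
    reach-extend k {a} {w} {b} a⇝w w~b =
      ∨-true⁺ʳ (reachK S k a b) (any-true⁺ _ (∈-allFin w) (∧-true⁺ a⇝w w~b))

    reach-suc⁻ : ∀ k {a b} → reachK S (suc k) a b ≡ true →
      reachK S k a b ≡ true ⊎ ∃[ w ] (reachK S k a w ≡ true × adj S w b ≡ true)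
    reach-suc⁻ k {a} a⇝b with ∨-true⁻ {reachK S k a _} a⇝b
    ... | inj₁ a⇝b′   = inj₁ a⇝b′
    ... | inj₂ via-w = let w , _ , a⇝w∧w~b = any-true⁻ _ (allFin n) via-w in inj₂ (w , ∧-true⁻ a⇝w∧w~b)

    reach-prepend : ∀ k {a w b} → adj S a w ≡ true → reachK S k w b ≡ true → reachK S (suc k) a b ≡ true
    reach-prepend zero    {a} a~w w==b with ==⇒≡ w==b
    ... | refl = reach-extend zero (==-refl a) a~w
    reach-prepend (suc k) a~w w⇝b with reach-suc⁻ k w⇝b
    ... | inj₁ w⇝b′             = reach-weaken (suc k) (reach-prepend k a~w w⇝b′)
    ... | inj₂ (x , w⇝x , x~b) = reach-extend (suc k) (reach-prepend k a~w w⇝x) x~b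

    reach-sym : ∀ k {a b} → reachK S k a b ≡ true → reachK S k b a ≡ true
    reach-sym zero    {a} {b} a==b = trans (==-sym b a) a==b
    reach-sym (suc k) {a} {b} a⇝b with reach-suc⁻ k a⇝b
    ... | inj₁ a⇝b′             = reach-weaken k (reach-sym k a⇝b′)
    ... | inj₂ (w , a⇝w , w~b) = reach-prepend k (trans (adj-sym S b w) w~b) (reach-sym k a⇝w)

    reach-trans : ∀ j k {a b c} → reachK S j a b ≡ true → reachK S k b c ≡ true →
      reachK S (j + k) a c ≡ true
    reach-trans j zero    {a} a⇝b b==c with ==⇒≡ b==c
    ... | refl = subst (λ l → reachK S l a _ ≡ true) (sym (+-identityʳ j)) a⇝b
    reach-trans j (suc k) a⇝b b⇝c rewrite +-suc j k with reach-suc⁻ k b⇝c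
    ... | inj₁ b⇝c′             = reach-weaken (j + k) (reach-trans j k a⇝b b⇝c′)
    ... | inj₂ (w , b⇝w , w~c) = reach-extend (j + k) (reach-trans j k a⇝b b⇝w) w~c

    reach-mono : ∀ {j k a b} → j ≤ k → reachK S j a b ≡ true → reachK S k a b ≡ true
    reach-mono {j} {k} {a} {b} j≤k a⇝b with m≤n⇒∃[o]m+o≡n j≤k
    ... | o , refl = weaken o
      where
      weaken : ∀ o → reachK S (j + o) a b ≡ true
      weaken zero    = subst (λ l → reachK S l a b ≡ true) (sym (+-identityʳ j)) a⇝b
      weaken (suc o) = subst (λ l → reachK S l a b ≡ true) (sym (+-suc j o)) (reach-weaken (j + o) (weaken o))

    -- The vertices reachable from a in k steps grow with k and stop growing for good after the first step
    -- that adds none; with only n vertices this happens within n steps.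
    module _ (a : Fin n) where

      private
        reached : ℕ → ℕ
        reached k = count (reachK S k a) (allFin n)

        Stable : ℕ → Set
        Stable k = ∀ b → reachK S (suc k) a b ≡ true → reachK S k a b ≡ true

      stable-absorbs : ∀ {i} → Stable i → ∀ k {b} → reachK S (k + i) a b ≡ true → reachK S i a b ≡ true
      stable-absorbs st zero    a⇝b = a⇝b
      stable-absorbs {i} st (suc k) {b} a⇝b with reach-suc⁻ (k + i) a⇝b
      ... | inj₁ a⇝b′             = stable-absorbs st k a⇝b′
      ... | inj₂ (w , a⇝w , w~b) = st b (reach-extend i (stable-absorbs st k a⇝w) w~b)

      stable-or-growing : ∀ j → ∃[ i ] (i ≤ j × Stable i) ⊎ j < reached j
      stable-or-growing zero = inj₂ (count-pos _ (∈-allFin a) (==-refl a))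
      stable-or-growing (suc j) with stable-or-growing j
      ... | inj₁ (i , i≤j , st) = inj₁ (i , m≤n⇒m≤1+n i≤j , st)
      ... | inj₂ j<reached with any (λ b → reachK S (suc j) a b ∧ not (reachK S j a b)) (allFin n) in new?
      ...   | true  = let b , _ , new = any-true⁻ _ (allFin n) new?
                          a⇝b , ¬a⇝b = ∧-true⁻ {reachK S (suc j) a b} new
                      in inj₂ (≤-trans (s≤s j<reached) (count-mono-< (allFin n) (λ _ → reach-weaken j)
                                                           (∈-allFin b) (not-true⇒false ¬a⇝b) a⇝b))
      ...   | false = inj₁ (j , n≤1+n j , λ b a⇝b →
                              not-false⇒true (∧-false-true (any-false⁻ _ new? (∈-allFin b)) a⇝b))

      reach⇒connected : ∀ k {b} → reachK S k a b ≡ true → connected S a b ≡ true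
      reach⇒connected k a⇝b with stable-or-growing n
      ... | inj₁ (i , i≤n , st) = reach-mono i≤n (stable-absorbs st k (reach-mono (m≤m+n k i) a⇝b))
      ... | inj₂ n<reached      = contradiction (≤-trans n<reached (reached≤n n)) (<-irrefl refl)
        where
        reached≤n : ∀ k → reached k ≤ n
        reached≤n k = ≤-trans (count≤length _ (allFin n)) (≤-reflexive (length-tabulate id))

    connected-refl : ∀ a → connected S a a ≡ true
    connected-refl a = reach⇒connected a zero (==-refl a)

    connected-sym : ∀ {a b} → connected S a b ≡ true → connected S b a ≡ true
    connected-sym = reach-sym n

    connected-trans : ∀ {a b c} → connected S a b ≡ true → connected S b c ≡ true → connected S a c ≡ true
    connected-trans a~b b~c = reach⇒connected _ (n + n) (reach-trans n n a~b b~c)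

    connected-adj : ∀ {a b} → adj S a b ≡ true → connected S a b ≡ true
    connected-adj {a} a~b = reach⇒connected a 1 (reach-extend zero (==-refl a) a~b)

  reach-⊆ : {S T : List (Edge n)} → (∀ {a b} → adj S a b ≡ true → adj T a b ≡ true) →
    ∀ k {a b} → reachK S k a b ≡ true → reachK T k a b ≡ true
  reach-⊆ S⊆T zero    a==b = a==b
  reach-⊆ {S} {T} S⊆T (suc k) a⇝b with reach-suc⁻ S k a⇝b
  ... | inj₁ a⇝b′             = reach-weaken T k (reach-⊆ S⊆T k a⇝b′)
  ... | inj₂ (w , a⇝w , w~b) = reach-extend T k (reach-⊆ S⊆T k a⇝w) (S⊆T w~b)

  isRep : (Fin n → Fin n → Bool) → Fin n → Bool
  isRep c x = not (any (λ y → ⌊ y <? x ⌋ ∧ c y x) (allFin n))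

  components≡count-isRep : (S : List (Edge n)) → components S ≡ count (isRep (connected S)) (allFin n)
  components≡count-isRep S = count-filter _ (allFin n)

  isRep-true : (c : Fin n → Fin n → Bool) {x : Fin n} → (∀ y → toℕ y < toℕ x → ¬ c y x ≡ true) →
    isRep c x ≡ true
  isRep-true c {x} minimal = cong not (any-false⁺ _ (allFin n) (λ y _ → not-before y))
    where
    not-before : ∀ y → (⌊ y <? x ⌋ ∧ c y x) ≡ false
    not-before y with y <? x | c y x in cyx
    ... | yes y<x | true  = contradiction cyx (minimal y y<x)
    ... | yes _   | false = refl
    ... | no _    | _     = refl

  isRep-false : (c : Fin n → Fin n → Bool) {x y : Fin n} → toℕ y < toℕ x → c y x ≡ true → isRep c x ≡ false
  isRep-false c {x} {y} y<x cyx = cong not (any-true⁺ _ (∈-allFin y) (∧-true⁺ (⌊⌋-true (y <? x) y<x) cyx))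

  isRep-cong : (c c′ : Fin n → Fin n → Bool) (x : Fin n) → (∀ y → c y x ≡ c′ y x) →
    isRep c x ≡ isRep c′ x
  isRep-cong c c′ x c≗c′ = cong not (any-cong (allFin n) (λ y _ → cong (⌊ y <? x ⌋ ∧_) (c≗c′ y)))

  components-cong : (S T : List (Edge n)) → (∀ a b → adj S a b ≡ adj T a b) → components S ≡ components T
  components-cong S T S≈T = begin
    components S
      ≡⟨ components≡count-isRep S ⟩
    count (isRep (connected S)) (allFin n)
      ≡⟨ count-cong (allFin n) (λ x _ → isRep-cong (connected S) (connected T) x (connected-≡ x)) ⟩
    count (isRep (connected T)) (allFin n)
      ≡⟨ components≡count-isRep T ⟨
    components T ∎
    where
    open ≡-Reasoning
    connected-≡ : ∀ x y → connected S y x ≡ connected T y x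
    connected-≡ x y = ⇔→≡ (mk⇔ (reach-⊆ (λ {a} {b} → subst (_≡ true) (S≈T a b)) n)
                               (reach-⊆ (λ {a} {b} → subst (_≡ true) (sym (S≈T a b))) n))

  components-↭ : {S T : List (Edge n)} → S ↭ T → components S ≡ components T
  components-↭ {S} {T} S↭T = components-cong S T (λ a b → any-↭ _ S↭T)

  components-flip : (S : List (Edge n)) (u v : Fin n) → components ((u , v) ∷ S) ≡ components ((v , u) ∷ S)
  components-flip S u v = components-cong _ _ (λ a b → cong (_∨ adj S a b) (flip-edge a b))
    where
    flip-edge : ∀ a b → ((u == a) ∧ (v == b)) ∨ ((u == b) ∧ (v == a)) ≡
                        ((v == a) ∧ (u == b)) ∨ ((v == b) ∧ (u == a))
    flip-edge a b =
      trans (∨-comm ((u == a) ∧ (v == b)) _) (cong₂ _∨_ (∧-comm (u == b) (v == a)) (∧-comm (u == a) (v == b)))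

least : ∀ {n} (P : Fin n → Bool) {x : Fin n} → P x ≡ true →
  ∃[ r ] (P r ≡ true × ∀ y → toℕ y < toℕ r → P y ≡ false)
least {suc n} P {x} Px with P zero in P0
... | true  = zero , P0 , λ y ()
... | false with x
...   | zero   = contradiction (trans (sym Px) P0) λ ()
...   | suc x′ = let r , Pr , minimal = least (P ∘ suc) Px
                 in suc r , Pr , λ { zero _ → P0 ; (suc y) (s≤s y<r) → minimal y y<r }

-- Attaching v, isolated in S, to u merges {v} into the component of u.  Of the two least vertices v and
-- r (the least vertex connected to u) only the smaller one remains least in its component of S′.
module PendantEdge {n : ℕ} (S : List (Edge n)) {u v : Fin n} (u≢v : u ≢ v) (v-isolated : covers S v ≡ false) where

  S′ : List (Edge n)
  S′ = (u , v) ∷ S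

  adj-isolated : ∀ w → adj S w v ≡ false
  adj-isolated w = any-false⁺ _ S (λ e e∈S → not-at-v e (any-false⁻ (incident v) v-isolated e∈S))
    where
    not-at-v : ∀ e → incident v e ≡ false →
      (((proj₁ e == w) ∧ (proj₂ e == v)) ∨ ((proj₁ e == v) ∧ (proj₂ e == w))) ≡ false
    not-at-v (a , b) v∉ab
      rewrite ==-sym b v | ==-sym a v | ∨-conicalˡ (v == a) _ v∉ab | ∨-conicalʳ (v == a) _ v∉ab =
      trans (∨-identityʳ _) (∧-zeroʳ (a == w))

  reach-isolated : ∀ k {y} → reachK S k y v ≡ true → y ≡ v
  reach-isolated zero    y==v = ==⇒≡ y==v
  reach-isolated (suc k) y⇝v with reach-suc⁻ S k y⇝v
  ... | inj₁ y⇝v′          = reach-isolated k y⇝v′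
  ... | inj₂ (w , _ , w~v) = contradiction (trans (sym w~v) (adj-isolated w)) λ ()

  connected-isolated : ∀ {y} → connected S y v ≡ true → y ≡ v
  connected-isolated = reach-isolated n

  joined : Fin n → Bool
  joined x = connected S x u ∨ (x == v)

  joined-u : joined u ≡ true
  joined-u = ∨-true⁺ˡ _ (connected-refl S u)

  joined-v : joined v ≡ true
  joined-v = ∨-true⁺ʳ _ (==-refl v)

  joined-resp-connected : ∀ {a x} → connected S a x ≡ true → joined x ≡ true → joined a ≡ true
  joined-resp-connected a~x jx with ∨-true⁻ jx
  ... | inj₁ x~u = ∨-true⁺ˡ _ (connected-trans S a~x x~u)
  ... | inj₂ x==v with ==⇒≡ x==v
  ...   | refl = subst (λ a → joined a ≡ true) (sym (connected-isolated a~x)) joined-v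

  new-edge-joined : ∀ {w b} → (((u == w) ∧ (v == b)) ∨ ((u == b) ∧ (v == w))) ≡ true →
    joined w ≡ true × joined b ≡ true
  new-edge-joined {w} {b} uv~wb with ∨-true⁻ {(u == w) ∧ (v == b)} uv~wb
  ... | inj₁ uw∧vb with ∧-true⁻ uw∧vb
  ...   | u==w , v==b with ==⇒≡ {a = u} {b = w} u==w | ==⇒≡ {a = v} {b = b} v==b
  ...     | refl | refl = joined-u , joined-v
  new-edge-joined {w} {b} uv~wb | inj₂ ub∧vw with ∧-true⁻ ub∧vw
  ...   | u==b , v==w with ==⇒≡ {a = u} {b = b} u==b | ==⇒≡ {a = v} {b = w} v==w
  ...     | refl | refl = joined-v , joined-u

  reach-S′⁻ : ∀ k {a b} → reachK S′ k a b ≡ true →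
    connected S a b ≡ true ⊎ (joined a ≡ true × joined b ≡ true)
  reach-S′⁻ zero {a} a==b rewrite ==⇒≡ a==b = inj₁ (connected-refl S _)
  reach-S′⁻ (suc k) a⇝b with reach-suc⁻ S′ k a⇝b
  ... | inj₁ a⇝b′ = reach-S′⁻ k a⇝b′
  ... | inj₂ (w , a⇝w , w~b) with ∨-true⁻ w~b | reach-S′⁻ k a⇝w
  ...   | inj₁ new | a~w            = let jw , jb = new-edge-joined new
                                       in inj₂ ([ (λ a~w → joined-resp-connected a~w jw) , proj₁ ] a~w , jb)
  ...   | inj₂ old | inj₁ a~w       = inj₁ (connected-trans S a~w (connected-adj S old))
  ...   | inj₂ old | inj₂ (ja , jw) = inj₂ (ja , joined-resp-connected (connected-adj S (trans (adj-sym S _ _) old)) jw)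

  connected⇒connected′ : ∀ {a b} → connected S a b ≡ true → connected S′ a b ≡ true
  connected⇒connected′ = reach-⊆ (∨-true⁺ʳ _) n

  joined⇒connected′-u : ∀ {a} → joined a ≡ true → connected S′ a u ≡ true
  joined⇒connected′-u ja with ∨-true⁻ ja
  ... | inj₁ a~u  = connected⇒connected′ a~u
  ... | inj₂ a==v rewrite ==⇒≡ a==v =
    connected-adj S′ (∨-true⁺ˡ _ (∨-true⁺ʳ ((u == v) ∧ (v == u)) (∧-true⁺ (==-refl u) (==-refl v))))

  joined⇒connected′ : ∀ {a b} → joined a ≡ true → joined b ≡ true → connected S′ a b ≡ true
  joined⇒connected′ ja jb =
    connected-trans S′ (joined⇒connected′-u ja) (connected-sym S′ (joined⇒connected′-u jb))

  connected′-apart : ∀ y {x} → joined x ≡ false → connected S y x ≡ connected S′ y x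
  connected′-apart y jx = ⇔→≡ (mk⇔ connected⇒connected′ from-S′)
    where
    from-S′ : connected S′ y _ ≡ true → connected S y _ ≡ true
    from-S′ y~x with reach-S′⁻ n y~x
    ... | inj₁ y~x′     = y~x′
    ... | inj₂ (_ , jx′) = contradiction (trans (sym jx′) jx) λ ()

  least-in-component : ∃[ r ] (connected S r u ≡ true × ∀ y → toℕ y < toℕ r → connected S y u ≡ false)
  least-in-component = least (λ x → connected S x u) (connected-refl S u)

  r : Fin n
  r = proj₁ least-in-component

  r~u : connected S r u ≡ true
  r~u = proj₁ (proj₂ least-in-component)

  r-least : ∀ y → toℕ y < toℕ r → connected S y u ≡ false
  r-least = proj₂ (proj₂ least-in-component)

  joined-r : joined r ≡ true
  joined-r = ∨-true⁺ˡ _ r~u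

  r≢v : r ≢ v
  r≢v refl = u≢v (connected-isolated (connected-sym S r~u))

  r<x : ∀ {x} → connected S x u ≡ true → x ≢ r → toℕ r < toℕ x
  r<x {x} x~u x≢r = ≤∧≢⇒< (≮⇒≥ x≮r) (x≢r ∘ toℕ-injective ∘ sym)
    where
    x≮r : ¬ toℕ x < toℕ r
    x≮r x<r = contradiction (trans (sym (r-least x x<r)) x~u) λ ()

  joined-below-r : ∀ {y} → toℕ y < toℕ r → joined y ≡ true → y ≡ v
  joined-below-r y<r jy rewrite r-least _ y<r = ==⇒≡ jy

  connected′-joined : ∀ {x y} → connected S′ y x ≡ true → joined x ≡ true → joined y ≡ true
  connected′-joined y~x jx = [ (λ y~x′ → joined-resp-connected y~x′ jx) , proj₁ ] (reach-S′⁻ n y~x)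

  isRep-r : isRep (connected S) r ≡ true
  isRep-r = isRep-true (connected S) λ y y<r y~r →
    contradiction (trans (sym (r-least y y<r)) (connected-trans S y~r r~u)) λ ()

  isRep-v : isRep (connected S) v ≡ true
  isRep-v = isRep-true (connected S) (λ y y<v y~v → <-irrefl (cong toℕ (connected-isolated y~v)) y<v)

  isRep′-r-or-v : indicator (isRep (connected S′) v) + indicator (isRep (connected S′) r) ≡ 1
  isRep′-r-or-v with <-cmp (toℕ r) (toℕ v)
  ... | tri< r<v _ _ rewrite isRep-false (connected S′) r<v (joined⇒connected′ joined-r joined-v)
                           | isRep-true (connected S′) {r} (λ y y<r y~r → <-asym r<v (subst (λ x → toℕ x < toℕ r)
                               (joined-below-r y<r (connected′-joined y~r joined-r)) y<r)) = refl
  ... | tri≈ _ r≡v _ = contradiction (toℕ-injective r≡v) r≢v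
  ... | tri> _ _ v<r rewrite isRep-false (connected S′) v<r (joined⇒connected′ joined-v joined-r)
                           | isRep-true (connected S′) {v} (λ y y<v y~v → <-irrefl (cong toℕ
                               (joined-below-r (<-trans y<v v<r) (connected′-joined y~v joined-v))) y<v) = refl

  isRep-elsewhere : ∀ x → x ≢ v → x ≢ r → isRep (connected S) x ≡ isRep (connected S′) x
  isRep-elsewhere x x≢v x≢r with connected S x u in x~u
  ... | true  = trans (isRep-false (connected S) (r<x x~u x≢r) r~x)
                      (sym (isRep-false (connected S′) (r<x x~u x≢r) (connected⇒connected′ r~x)))
    where
    r~x : connected S r x ≡ true
    r~x = connected-trans S r~u (connected-sym S x~u)
  ... | false = isRep-cong (connected S) (connected S′) x λ y →
                  connected′-apart y (trans (cong (_∨ (x == v)) x~u) (⌊⌋-false (x ≟ v) x≢v))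

  count-isRep-split : (c : Fin n → Fin n → Bool) → count (isRep c) (allFin n) ≡
    indicator (isRep c v) +
    (indicator (isRep c r) + count (λ x → (isRep c x ∧ not (x == v)) ∧ not (x == r)) (allFin n))
  count-isRep-split c = begin
    count (isRep c) (allFin n)
      ≡⟨ count-split _≟_ (isRep c) (allFin⁺ n) (∈-allFin v) ⟩
    indicator (isRep c v) + count (λ x → isRep c x ∧ not (x == v)) (allFin n)
      ≡⟨ cong (indicator (isRep c v) +_) (count-split _≟_ _ (allFin⁺ n) (∈-allFin r)) ⟩
    indicator (isRep c v) + (indicator (isRep c r ∧ not (r == v)) + rest)
      ≡⟨ cong (λ b → indicator (isRep c v) + (indicator (isRep c r ∧ not b) + rest)) (⌊⌋-false (r ≟ v) r≢v) ⟩
    indicator (isRep c v) + (indicator (isRep c r ∧ true) + rest)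
      ≡⟨ cong (λ b → indicator (isRep c v) + (indicator b + rest)) (∧-identityʳ (isRep c r)) ⟩
    indicator (isRep c v) + (indicator (isRep c r) + rest) ∎
    where
    open ≡-Reasoning
    rest : ℕ
    rest = count (λ x → (isRep c x ∧ not (x == v)) ∧ not (x == r)) (allFin n)

  components-drop : components S ≡ suc (components S′)
  components-drop = begin
    components S
      ≡⟨ components≡count-isRep S ⟩
    count (isRep (connected S)) (allFin n)
      ≡⟨ count-isRep-split (connected S) ⟩
    indicator (isRep (connected S) v) + (indicator (isRep (connected S) r) + rest (connected S))
      ≡⟨ cong₂ (λ a b → indicator a + (indicator b + rest (connected S))) isRep-v isRep-r ⟩
    suc (suc (rest (connected S)))
      ≡⟨ cong (λ k → suc (suc k)) (count-cong (allFin n) (λ x _ → rest-same x)) ⟩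
    suc (suc (rest (connected S′)))
      ≡⟨ cong (λ k → suc (k + rest (connected S′))) isRep′-r-or-v ⟨
    suc (indicator (isRep (connected S′) v) + indicator (isRep (connected S′) r) + rest (connected S′))
      ≡⟨ cong suc (+-assoc (indicator (isRep (connected S′) v)) _ _) ⟩
    suc (indicator (isRep (connected S′) v) + (indicator (isRep (connected S′) r) + rest (connected S′)))
      ≡⟨ cong suc (count-isRep-split (connected S′)) ⟨
    suc (count (isRep (connected S′)) (allFin n))
      ≡⟨ cong suc (components≡count-isRep S′) ⟨
    suc (components S′) ∎
    where
    open ≡-Reasoning
    rest : (Fin n → Fin n → Bool) → ℕ
    rest c = count (λ x → (isRep c x ∧ not (x == v)) ∧ not (x == r)) (allFin n)
    rest-same : ∀ x → ((isRep (connected S) x ∧ not (x == v)) ∧ not (x == r)) ≡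
                      ((isRep (connected S′) x ∧ not (x == v)) ∧ not (x == r))
    rest-same x with x ≟ v | x ≟ r
    ... | yes _   | _      =
      cong₂ _∧_ (trans (∧-zeroʳ (isRep (connected S) x)) (sym (∧-zeroʳ (isRep (connected S′) x)))) refl
    ... | no x≢v | yes _  = trans (∧-zeroʳ (isRep (connected S) x ∧ true)) (sym (∧-zeroʳ (isRep (connected S′) x ∧ true)))
    ... | no x≢v | no x≢r = cong (λ b → (b ∧ true) ∧ true) (isRep-elsewhere x x≢v x≢r)

-- The forest building process

module _ {n : ℕ} where

  touches : Edge n → Edge n → Bool
  touches (u , v) f = incident u f ∨ incident v f

  uncovered : List (Edge n) → ℕ
  uncovered C = count (λ w → not (covers C w)) (allFin n)

  freshCount : List (Edge n) → List (Edge n) → ℕ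
  freshCount C []       = 0
  freshCount C (e ∷ es) = indicator (not (any (touches e) C)) + freshCount (e ∷ C) es

  CoveredBy : List (Edge n) → List (Edge n) → Set
  CoveredBy S C = ∀ w → covers C w ≡ false → covers S w ≡ false

  NoLoop : Edge n → Set
  NoLoop e = proj₁ e ≢ proj₂ e

  uncovered-↭ : {C D : List (Edge n)} → C ↭ D → uncovered C ≡ uncovered D
  uncovered-↭ C↭D = count-cong (allFin n) (λ w _ → cong not (any-↭ (incident w) C↭D))

  uncovered-cons : (C : List (Edge n)) {u v : Fin n} → u ≢ v →
    uncovered C ≡ indicator (not (covers C u)) + indicator (not (covers C v)) + uncovered ((u , v) ∷ C)
  uncovered-cons C {u} {v} u≢v = begin
    count p (allFin n)
      ≡⟨ count-split _≟_ p (allFin⁺ n) (∈-allFin u) ⟩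
    indicator (p u) + count (λ w → p w ∧ not (w == u)) (allFin n)
      ≡⟨ cong (indicator (p u) +_) (count-split _≟_ _ (allFin⁺ n) (∈-allFin v)) ⟩
    indicator (p u) + (indicator (p v ∧ not (v == u)) + count (λ w → (p w ∧ not (w == u)) ∧ not (w == v)) (allFin n))
      ≡⟨ cong₂ (λ b k → indicator (p u) + (indicator b + k))
           (trans (cong (λ b → p v ∧ not b) (⌊⌋-false (v ≟ u) (u≢v ∘ sym))) (∧-identityʳ (p v)))
           (count-cong (allFin n) (λ w _ → sym (not-∨-∨ (w == u) (w == v) (covers C w)))) ⟩
    indicator (p u) + (indicator (p v) + uncovered ((u , v) ∷ C))
      ≡⟨ +-assoc (indicator (p u)) _ _ ⟨
    indicator (p u) + indicator (p v) + uncovered ((u , v) ∷ C) ∎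
    where
    open ≡-Reasoning
    p : Fin n → Bool
    p w = not (covers C w)
    not-∨-∨ : ∀ a b c → not ((a ∨ b) ∨ c) ≡ (not c ∧ not a) ∧ not b
    not-∨-∨ true  b     c = sym (cong (_∧ not b) (∧-zeroʳ (not c)))
    not-∨-∨ false true  c = sym (∧-zeroʳ _)
    not-∨-∨ false false c = sym (trans (∧-identityʳ _) (∧-identityʳ (not c)))

  components-drop-edge : (S : List (Edge n)) {u v : Fin n} → u ≢ v → covers S u ≡ false ⊎ covers S v ≡ false →
    components S ≡ suc (components ((u , v) ∷ S))
  components-drop-edge S u≢v (inj₂ v-isolated) = PendantEdge.components-drop S u≢v v-isolated
  components-drop-edge S {u} {v} u≢v (inj₁ u-isolated) =
    trans (PendantEdge.components-drop S (u≢v ∘ sym) u-isolated) (cong suc (components-flip S v u))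

  CoveredBy-skip : {S C : List (Edge n)} (e : Edge n) → CoveredBy S C → CoveredBy S (e ∷ C)
  CoveredBy-skip e S⊑C w w∉e∷C = S⊑C w (∨-conicalʳ (incident w e) _ w∉e∷C)

  CoveredBy-add : {S C : List (Edge n)} (e : Edge n) → CoveredBy S C → CoveredBy (e ∷ S) (e ∷ C)
  CoveredBy-add e S⊑C w w∉e∷C rewrite ∨-conicalˡ (incident w e) _ w∉e∷C =
    S⊑C w (∨-conicalʳ (incident w e) _ w∉e∷C)

  isolated-endpoint : {S C : List (Edge n)} → CoveredBy S C → ∀ {u v} → not (covers C u) ∨ not (covers C v) ≡ true →
    covers S u ≡ false ⊎ covers S v ≡ false
  isolated-endpoint {C = C} S⊑C {u} {v} added with ∨-true⁻ {not (covers C u)} added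
  ... | inj₁ u-new = inj₁ (S⊑C u (not-true⇒false u-new))
  ... | inj₂ v-new = inj₂ (S⊑C v (not-true⇒false v-new))

  newly-covered : ∀ {a b} → not a ∨ not b ≡ true →
    indicator (not a) + indicator (not b) ≡ suc (indicator (not (a ∨ b)))
  newly-covered {false} {false} _ = refl
  newly-covered {false} {true}  _ = refl
  newly-covered {true}  {false} _ = refl

  touches-covers : (C : List (Edge n)) (u v : Fin n) → any (touches (u , v)) C ≡ covers C u ∨ covers C v
  touches-covers C u v = any-∨ (incident u) (incident v) C

  -- components − uncovered grows by one exactly at the fresh edges; stated without truncated subtraction.
  Invariant : (es C S : List (Edge n)) → Set
  Invariant es C S =
    components (S ++ build C es) + uncovered C ≡ components S + freshCount C es + uncovered (es ++ C)

  invariant-skip : (es C S : List (Edge n)) {u v : Fin n} → u ≢ v → not (covers C u) ∨ not (covers C v) ≡ false →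
    Invariant es ((u , v) ∷ C) S →
    components (S ++ build ((u , v) ∷ C) es) + uncovered C ≡
    components S + freshCount C ((u , v) ∷ es) + uncovered ((u , v) ∷ es ++ C)
  invariant-skip es C S {u} {v} u≢v skipped invariant = begin
    components (S ++ build C′ es) + uncovered C
      ≡⟨ cong (components (S ++ build C′ es) +_) (trans (uncovered-cons C u≢v)
           (cong₂ (λ a b → indicator (not a) + indicator (not b) + uncovered C′) cu cv)) ⟩
    components (S ++ build C′ es) + uncovered C′
      ≡⟨ invariant ⟩
    components S + freshCount C′ es + uncovered (es ++ C′)
      ≡⟨ cong₂ (λ f k → components S + f + k) (cong (λ b → indicator (not b) + freshCount C′ es) (sym old))
                                                 (uncovered-↭ (shift (u , v) es C)) ⟩
    components S + freshCount C ((u , v) ∷ es) + uncovered ((u , v) ∷ es ++ C) ∎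
    where
    open ≡-Reasoning
    C′ : List (Edge n)
    C′ = (u , v) ∷ C
    cu : covers C u ≡ true
    cu = not-false⇒true (∨-conicalˡ (not (covers C u)) _ skipped)
    cv : covers C v ≡ true
    cv = not-false⇒true (∨-conicalʳ (not (covers C u)) _ skipped)
    old : any (touches (u , v)) C ≡ true
    old = trans (touches-covers C u v) (cong₂ _∨_ cu cv)

  invariant-add : (es C S : List (Edge n)) {u v : Fin n} → u ≢ v → not (covers C u) ∨ not (covers C v) ≡ true →
    CoveredBy S C → Invariant es ((u , v) ∷ C) ((u , v) ∷ S) →
    components (S ++ (u , v) ∷ build ((u , v) ∷ C) es) + uncovered C ≡
    components S + freshCount C ((u , v) ∷ es) + uncovered ((u , v) ∷ es ++ C)
  invariant-add es C S {u} {v} u≢v added S⊑C invariant = begin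
    components (S ++ (u , v) ∷ later) + uncovered C
      ≡⟨ cong₂ _+_ (components-↭ (shift (u , v) S later))
                   (trans (uncovered-cons C u≢v) (cong (_+ uncovered C′) (newly-covered {covers C u} added))) ⟩
    components (S′ ++ later) + (suc f + uncovered C′)
      ≡⟨ x+[1+f+y]≡1+f+[x+y] (components (S′ ++ later)) f (uncovered C′) ⟩
    suc f + (components (S′ ++ later) + uncovered C′)
      ≡⟨ cong (suc f +_) invariant ⟩
    suc f + (components S′ + freshCount C′ es + uncovered (es ++ C′))
      ≡⟨ 1+f+[x+y+z]≡1+x+[f+y]+z f (components S′) (freshCount C′ es) (uncovered (es ++ C′)) ⟩
    suc (components S′) + (f + freshCount C′ es) + uncovered (es ++ C′)
      ≡⟨ cong₂ (λ c f′ → c + (f′ + freshCount C′ es) + uncovered (es ++ C′))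
           (sym (components-drop-edge S u≢v (isolated-endpoint {S} {C} S⊑C {u} {v} added)))
           (cong (indicator ∘ not) (sym (touches-covers C u v))) ⟩
    components S + freshCount C ((u , v) ∷ es) + uncovered (es ++ C′)
      ≡⟨ cong (components S + freshCount C ((u , v) ∷ es) +_) (uncovered-↭ (shift (u , v) es C)) ⟩
    components S + freshCount C ((u , v) ∷ es) + uncovered ((u , v) ∷ es ++ C) ∎
    where
    open ≡-Reasoning
    C′ S′ later : List (Edge n)
    C′ = (u , v) ∷ C
    S′ = (u , v) ∷ S
    later = build C′ es
    f : ℕ
    f = indicator (not (covers C u ∨ covers C v))
    x+[1+f+y]≡1+f+[x+y] : ∀ x f y → x + (suc f + y) ≡ suc f + (x + y)
    x+[1+f+y]≡1+f+[x+y] = solve-∀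
    1+f+[x+y+z]≡1+x+[f+y]+z : ∀ f x y z → suc f + (x + y + z) ≡ suc x + (f + y) + z
    1+f+[x+y+z]≡1+x+[f+y]+z = solve-∀

  build-invariant : (es C S : List (Edge n)) → All NoLoop es → CoveredBy S C → Invariant es C S
  build-invariant [] C S [] _ rewrite ++-identityʳ S = cong (_+ uncovered C) (sym (+-identityʳ (components S)))
  build-invariant ((u , v) ∷ es) C S (u≢v ∷ no-loops) S⊑C with not (covers C u) ∨ not (covers C v) in added?
  ... | false = invariant-skip es C S u≢v added?
                  (build-invariant es ((u , v) ∷ C) S no-loops (CoveredBy-skip {S} {C} (u , v) S⊑C))
  ... | true  = invariant-add es C S u≢v added? S⊑C
                  (build-invariant es ((u , v) ∷ C) ((u , v) ∷ S) no-loops (CoveredBy-add {S} {C} (u , v) S⊑C))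

  reach-[] : ∀ k {y x : Fin n} → reachK [] k y x ≡ true → y ≡ x
  reach-[] zero    y==x = ==⇒≡ y==x
  reach-[] (suc k) y⇝x with reach-suc⁻ [] k y⇝x
  ... | inj₁ y⇝x′ = reach-[] k y⇝x′

  components-[] : components {n} [] ≡ n
  components-[] = begin
    components {n} []                           ≡⟨ components≡count-isRep {n} [] ⟩
    count (isRep (connected {n} [])) (allFin n) ≡⟨ count-all _ (allFin n) (λ x _ → isRep-true (connected {n} []) λ y y<x y~x →
                                                     <-irrefl (cong toℕ (reach-[] n y~x)) y<x) ⟩
    length (allFin n)                           ≡⟨ length-tabulate id ⟩
    n                                           ∎
    where open ≡-Reasoning

  uncovered-[] : uncovered [] ≡ n
  uncovered-[] = trans (count-all _ (allFin n) (λ _ _ → refl)) (length-tabulate id)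

  uncovered-all : (C : List (Edge n)) → (∀ w → covers C w ≡ true) → uncovered C ≡ 0
  uncovered-all C covering = count-none _ (allFin n) (λ w _ → cong not (covering w))

  components-forestOf : (σ : List (Edge n)) → All NoLoop σ → (∀ w → covers σ w ≡ true) →
    components (forestOf σ) ≡ freshCount [] σ
  components-forestOf σ no-loops covering = +-cancelˡ-≡ n _ _ (begin
    n + components (forestOf σ)                            ≡⟨ +-comm n _ ⟩
    components (forestOf σ) + n                            ≡⟨ cong (components (forestOf σ) +_) uncovered-[] ⟨
    components ([] ++ build [] σ) + uncovered []           ≡⟨ build-invariant σ [] [] no-loops (λ _ _ → refl) ⟩
    components {n} [] + freshCount [] σ + uncovered (σ ++ [])
      ≡⟨ cong₂ (λ c k → c + freshCount [] σ + k) components-[] (uncovered-all (σ ++ []) covering′) ⟩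
    n + freshCount [] σ + 0                                ≡⟨ +-identityʳ _ ⟩
    n + freshCount [] σ                                    ∎)
    where
    open ≡-Reasoning
    covering′ : ∀ w → covers (σ ++ []) w ≡ true
    covering′ w = subst (λ C → covers C w ≡ true) (sym (++-identityʳ σ)) (covering w)

  _≟ₑ_ : DecidableEquality (Edge n)
  _≟ₑ_ = ≡-dec _≟_ _≟_

  touches-refl : (e : Edge n) → touches e e ≡ true
  touches-refl (u , v) = ∨-true⁺ˡ _ (∨-true⁺ˡ _ (==-refl u))

  freshCount≡count-leads : (C σ : List (Edge n)) → Unique σ →
    freshCount C σ ≡ count (λ e → not (any (touches e) C) ∧ leads _≟ₑ_ (touches e) e σ) σ
  freshCount≡count-leads C []       _                   = refl
  freshCount≡count-leads C (x ∷ xs) (x∉xs ∷ xs-unique) =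
    cong₂ _+_ head (trans (freshCount≡count-leads (x ∷ C) xs xs-unique) (count-cong xs tail))
    where
    head : indicator (not (any (touches x) C)) ≡
           indicator (not (any (touches x) C) ∧ leads _≟ₑ_ (touches x) x (x ∷ xs))
    head rewrite touches-refl x | ⌊⌋-true (x ≟ₑ x) refl = cong indicator (sym (∧-identityʳ _))
    tail : ∀ e → e ∈ xs →
      (not (any (touches e) (x ∷ C)) ∧ leads _≟ₑ_ (touches e) e xs) ≡
      (not (any (touches e) C) ∧ leads _≟ₑ_ (touches e) e (x ∷ xs))
    tail e e∈xs with touches e x
    ... | true rewrite ⌊⌋-false (x ≟ₑ e) (All.lookup x∉xs e∈xs) = sym (∧-zeroʳ _)
    ... | false = refl

  incident⁻ : ∀ {w a b : Fin n} → incident w (a , b) ≡ true → w ≡ a ⊎ w ≡ b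
  incident⁻ w∈ab with ∨-true⁻ w∈ab
  ... | inj₁ w==a = inj₁ (==⇒≡ w==a)
  ... | inj₂ w==b = inj₂ (==⇒≡ w==b)

  ordered-edge-endpoints : ∀ {a b u v : Fin n} → toℕ a < toℕ b → toℕ u < toℕ v →
    incident u (a , b) ≡ true → incident v (a , b) ≡ true → (a , b) ≡ (u , v)
  ordered-edge-endpoints {a} {b} {u} {v} a<b u<v u∈ab v∈ab
    with incident⁻ {u} {a} {b} u∈ab | incident⁻ {v} {a} {b} v∈ab
  ... | inj₁ refl | inj₁ refl = contradiction u<v (<-irrefl refl)
  ... | inj₁ refl | inj₂ refl = refl
  ... | inj₂ refl | inj₁ refl = contradiction a<b (<-asym u<v)
  ... | inj₂ refl | inj₂ refl = contradiction u<v (<-irrefl refl)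

  count-touches : (E : List (Edge n)) → All (λ e → toℕ (proj₁ e) < toℕ (proj₂ e)) E → Unique E →
    ∀ {u v} → (u , v) ∈ E → count (touches (u , v)) E + 1 ≡ deg E u + deg E v
  count-touches E ordered E-unique {u} {v} uv∈E = begin
    count (touches (u , v)) E + 1
      ≡⟨ cong (count (touches (u , v)) E +_) unique-edge ⟨
    count (touches (u , v)) E + count (λ f → incident u f ∧ incident v f) E
      ≡⟨ count-∨-∧ (incident u) (incident v) E ⟩
    count (incident u) E + count (incident v) E
      ≡⟨ cong₂ _+_ (count-filter (incident u) E) (count-filter (incident v) E) ⟨
    deg E u + deg E v ∎
    where
    open ≡-Reasoning
    both≡ : ∀ f → f ∈ E → (incident u f ∧ incident v f) ≡ ⌊ f ≟ₑ (u , v) ⌋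
    both≡ f f∈E with f ≟ₑ (u , v)
    ... | yes refl  = ∧-true⁺ (∨-true⁺ˡ _ (==-refl u)) (∨-true⁺ʳ (v == u) (==-refl v))
    ... | no f≢uv = ¬-not λ both → let u∈f , v∈f = ∧-true⁻ both in
                      f≢uv (ordered-edge-endpoints (All.lookup ordered f∈E) (All.lookup ordered uv∈E) u∈f v∈f)
    unique-edge : count (λ f → incident u f ∧ incident v f) E ≡ 1
    unique-edge = trans (count-cong E both≡) (count-≟ _≟ₑ_ E-unique uv∈E)

  covers-endpoint : {E : List (Edge n)} (w : Fin n) → Any (λ e → proj₁ e ≡ w ⊎ proj₂ e ≡ w) E →
    covers E w ≡ true
  covers-endpoint w w∈E with find w∈E
  ... | (a , b) , ab∈E , inj₁ refl = any-true⁺ (incident a) ab∈E (∨-true⁺ˡ _ (==-refl a))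
  ... | (a , b) , ab∈E , inj₂ refl = any-true⁺ (incident b) ab∈E (∨-true⁺ʳ (b == a) (==-refl b))

-- Rationals

/-distribʳ-+ : ∀ a b d .{{_ : NonZero d}} → (ℤ.+ (a + b)) / d ≡ (ℤ.+ a) / d ℚ.+ (ℤ.+ b) / d
/-distribʳ-+ a b (suc d-1) = toℚᵘ-injective (begin
  toℚᵘ (fromℚᵘ (mkℚᵘ (ℤ.+ (a + b)) d-1))
    ≈⟨ toℚᵘ-fromℚᵘ (mkℚᵘ (ℤ.+ (a + b)) d-1) ⟩
  mkℚᵘ (ℤ.+ (a + b)) d-1
    ≈⟨ *≡* cross ⟩
  mkℚᵘ (ℤ.+ a) d-1 ℚᵘ.+ mkℚᵘ (ℤ.+ b) d-1
    ≈⟨ ℚᵘ.+-cong (toℚᵘ-fromℚᵘ (mkℚᵘ (ℤ.+ a) d-1)) (toℚᵘ-fromℚᵘ (mkℚᵘ (ℤ.+ b) d-1)) ⟨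
  toℚᵘ ((ℤ.+ a) / suc d-1) ℚᵘ.+ toℚᵘ ((ℤ.+ b) / suc d-1)
    ≈⟨ toℚᵘ-homo-+ ((ℤ.+ a) / suc d-1) ((ℤ.+ b) / suc d-1) ⟨
  toℚᵘ ((ℤ.+ a) / suc d-1 ℚ.+ (ℤ.+ b) / suc d-1) ∎)
  where
  open ℚᵘ.≃-Reasoning
  distrib : ∀ x y z → (x ℤ.+ y) ℤ.* (z ℤ.* z) ≡ (x ℤ.* z ℤ.+ y ℤ.* z) ℤ.* z
  distrib = ℤ-Solver.solve-∀
  D : ℕ
  D = suc d-1
  cross : (ℤ.+ (a + b)) ℤ.* (ℤ.+ (D * D)) ≡ ((ℤ.+ a) ℤ.* (ℤ.+ D) ℤ.+ (ℤ.+ b) ℤ.* (ℤ.+ D)) ℤ.* (ℤ.+ D)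
  cross rewrite pos-+ a b | pos-* D D = distrib (ℤ.+ a) (ℤ.+ b) (ℤ.+ D)

/≡recip : ∀ g k d .{{_ : NonZero d}} → g * k ≡ d → (ℤ.+ g) / d ≡ recip k
/≡recip g zero    (suc d-1) g*0≡d with () ← trans (sym (*-zeroʳ g)) g*0≡d
/≡recip g (suc k) (suc d-1) g*k≡d = fromℚᵘ-cong {mkℚᵘ (ℤ.+ g) d-1} {mkℚᵘ (ℤ.+ 1) k} (*≡* cross)
  where
  cross : (ℤ.+ g) ℤ.* (ℤ.+ suc k) ≡ (ℤ.+ 1) ℤ.* (ℤ.+ suc d-1)
  cross = trans (sym (pos-* g (suc k))) (trans (cong ℤ.+_ g*k≡d) (sym (ℤ.*-identityˡ (ℤ.+ suc d-1))))

/-sum : (g h : A → ℕ) (d : ℕ) .{{_ : NonZero d}} (xs : List A) → (∀ x → x ∈ xs → g x * h x ≡ d) →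
  (ℤ.+ sum (map g xs)) / d ≡ sumℚ (map (recip ∘ h) xs)
/-sum g h d []       _     = 0/n≡0 d
/-sum g h d (x ∷ xs) g*h≡d = begin
  (ℤ.+ (g x + sum (map g xs))) / d
    ≡⟨ /-distribʳ-+ (g x) (sum (map g xs)) d ⟩
  (ℤ.+ g x) / d ℚ.+ (ℤ.+ sum (map g xs)) / d
    ≡⟨ cong₂ ℚ._+_ (/≡recip (g x) (h x) d (g*h≡d x (here refl))) (/-sum g h d xs (λ y y∈xs → g*h≡d y (there y∈xs))) ⟩
  recip (h x) ℚ.+ sumℚ (map (recip ∘ h) xs) ∎
  where open ≡-Reasoning

module ForestProcess {n : ℕ} {E : List (Edge n)} (ordered : All (λ e → toℕ (proj₁ e) < toℕ (proj₂ e)) E)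
                     (E-unique : Unique E) (covering : ∀ w → covers E w ≡ true) where

  leadingOrderings : Edge n → ℕ
  leadingOrderings e = count (leads _≟ₑ_ (touches e) e) (orderings E)

  neighbourhoodSize : Edge n → ℕ
  neighbourhoodSize (u , v) = deg E u + deg E v ∸ 1

  components-forestOf-ordering : ∀ {σ} → σ ∈ orderings E →
    components (forestOf σ) ≡ count (λ e → leads _≟ₑ_ (touches e) e σ) E
  components-forestOf-ordering {σ} σ∈ = begin
    components (forestOf σ)                     ≡⟨ components-forestOf σ (All-resp-↭ E↭σ no-loops) σ-covering ⟩
    freshCount [] σ                             ≡⟨ freshCount≡count-leads [] σ (Unique-resp-↭ E↭σ E-unique) ⟩
    count (λ e → leads _≟ₑ_ (touches e) e σ) σ  ≡⟨ count-↭ _ σ↭E ⟩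
    count (λ e → leads _≟ₑ_ (touches e) e σ) E  ∎
    where
    open ≡-Reasoning
    σ↭E : σ ↭ E
    σ↭E = orderings-↭ E σ∈
    E↭σ : E ↭ σ
    E↭σ = ↭-sym σ↭E
    no-loops : All NoLoop E
    no-loops = All.map (λ u<v u≡v → <-irrefl (cong toℕ u≡v) u<v) ordered
    σ-covering : ∀ w → covers σ w ≡ true
    σ-covering w = trans (any-↭ (incident w) σ↭E) (covering w)

  sum-components≡sum-leadingOrderings :
    sum (map (components ∘ forestOf) (orderings E)) ≡ sum (map leadingOrderings E)
  sum-components≡sum-leadingOrderings =
    trans (sum-map-cong (orderings E) (λ σ σ∈ → components-forestOf-ordering σ∈))
          (sum-map-swap (λ σ e → indicator (leads _≟ₑ_ (touches e) e σ)) (orderings E) E)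

  leadingOrderings*neighbourhoodSize : ∀ e → e ∈ E → leadingOrderings e * neighbourhoodSize e ≡ length E !
  leadingOrderings*neighbourhoodSize (u , v) uv∈E =
    trans (cong (leadingOrderings (u , v) *_) (sym touches≡neighbourhoodSize))
          (count-leads _≟ₑ_ (touches (u , v)) (touches-refl (u , v)) (length E) refl E-unique uv∈E)
    where
    touches≡neighbourhoodSize : count (touches (u , v)) E ≡ neighbourhoodSize (u , v)
    touches≡neighbourhoodSize = trans (sym (m+n∸n≡m _ 1)) (cong (_∸ 1) (count-touches E ordered E-unique uv∈E))

theorem3 : (n : ℕ) (E : List (Edge n)) →
    All (λ e → toℕ (proj₁ e) < toℕ (proj₂ e)) E →
    Unique E →
    (∀ v → Any (λ e → proj₁ e ≡ v ⊎ proj₂ e ≡ v) E) →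
    expectedComponents E ≡ formula E
theorem3 n E ordered E-unique endpoints = begin
  expectedComponents E
    ≡⟨ cong (λ s → (ℤ.+ s) / length E !) sum-components≡sum-leadingOrderings ⟩
  (ℤ.+ sum (map leadingOrderings E)) / length E !
    ≡⟨ /-sum leadingOrderings neighbourhoodSize (length E !) E leadingOrderings*neighbourhoodSize ⟩
  formula E ∎
  where
  open ≡-Reasoning
  open ForestProcess ordered E-unique (λ w → covers-endpoint w (endpoints w))
  instance
    m!≢0 : NonZero (length E !)
    m!≢0 = length E !≢0
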